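{- Let $d\ge1$, $k\ge2$, and let $(f,a),(g,b)\in\wr_p^k\mathcal{IS}_d$ (so $f,g$ take values in $\wr_p^{k-1}\mathcal{IS}_d$, and Green's relations on these values are taken in $\wr_p^{k-1}\mathcal{IS}_d$). Then: (1) $(f,a)\,\mathcal L\,(g,b)$ if and only if $\mathrm{ran}(a)=\mathrm{ran}(b)$ and $g^{b^{ -1}}(z)\,\mathcal L\, f^{a^{ -1}}(z)$ for all $z\in\mathrm{ran}(a)$, where $a^{ -1}$ is the inverse of $a$ in $\mathcal{IS}_d$; (2) $(f,a)\,\mathcal R\,(g,b)$ if and only if $\mathrm{dom}(a)=\mathrm{dom}(b)$ and $f(z)\,\mathcal R\, g(z)$ for all $z\in\mathrm{dom}(a)$; (3) $(f,a)\,\mathcal H\,(g,b)$ if and only if $\mathrm{ran}(a)=\mathrm{ran}(b)$, $\mathrm{dom}(a)=\mathrm{dom}(b)$, $g^{b^{ -1}}(z)\,\mathcal L\, f^{a^{ -1}}(z)$ for all $z\in\mathrm{ran}(a)$, and $f(z)\,\mathcal R\, g(z)$ for all $z\in\mathrm{dom}(a)$; (4) $(f,a)\,\mathcal D\,(g,b)$ if and only if there exists a bijection $x:\mathrm{dom}(b)\to\mathrm{dom}(a)$ such that $f(zx)\,\mathcal D\, g(z)$ for all $z\in\mathrm{dom}(b)$; (5) $\mathcal D=\mathcal J$ on $\wr_p^k\mathcal{IS}_d$.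
   Context: $\mathcal{IS}_d$ is the semigroup of all injective partial maps of $N_d=\{1,\dots,d\}$ (including the empty map), written on the right, $x(ab)=(xa)b$, with domain $\mathrm{dom}$ and range $\mathrm{ran}$. For a semigroup $S$, $F(N_d,S)$ is the set of functions $f$ from a subset $\mathrm{dom}(f)\subseteq N_d$ to $S$ with $\mathrm{dom}(fg)=\mathrm{dom}(f)\cap\mathrm{dom}(g)$, $(fg)(x)=f(x)g(x)$; for $a\in\mathcal{IS}_d$, $\mathrm{dom}(f^a)=\{x\in\mathrm{dom}(a):xa\in\mathrm{dom}(f)\}$, $f^a(x)=f(xa)$. $S\wr_p\mathcal{IS}_d=\{(f,a)\in F(N_d,S)\times\mathcal{IS}_d:\mathrm{dom}(f)=\mathrm{dom}(a)\}$ with $(f,a)(g,b)=(fg^a,ab)$; $\wr_p^1\mathcal{IS}_d=\mathcal{IS}_d$ and $\wr_p^k\mathcal{IS}_d=(\wr_p^{k-1}\mathcal{IS}_d)\wr_p\mathcal{IS}_d$ for $k\ge2$. $\mathcal L,\mathcal R,\mathcal H,\mathcal D,\mathcal J$ are Green's relations. -}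

module Defs where

open import Data.Nat using (ℕ; zero; suc)
open import Data.Fin using (Fin)
open import Data.Vec using (Vec; lookup; tabulate)
open import Data.Maybe using (Maybe; just; nothing)
open import Data.Product using (Σ; ∃; ∃-syntax; _×_; _,_)
open import Data.Sum using (_⊎_)
open import Data.Unit using (⊤; tt)
open import Relation.Binary.PropositionalEquality using (_≡_)

-- All witnesses are required to lie in the subsemigroup; S¹ is modelled
-- by "either the element itself, or a genuine product".

module Green (C : Set) (Mem : C → Set) (_·_ : C → C → C) where

  ≤L : C → C → Set
  ≤L a b = a ≡ b ⊎ ∃[ s ] (Mem s × s · b ≡ a)

  ≤R : C → C → Set
  ≤R a b = a ≡ b ⊎ ∃[ s ] (Mem s × b · s ≡ a)

  -- elements of S¹, with nothing = adjoined identity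
  Mem¹ : Maybe C → Set
  Mem¹ nothing  = ⊤
  Mem¹ (just s) = Mem s

  lmul : Maybe C → C → C
  lmul nothing  b = b
  lmul (just s) b = s · b

  rmul : C → Maybe C → C
  rmul b nothing  = b
  rmul b (just s) = b · s

  ≤J : C → C → Set
  ≤J a b = ∃[ s ] ∃[ t ] (Mem¹ s × Mem¹ t × lmul s (rmul b t) ≡ a)

  GL GR GH GD GJ : C → C → Set
  GL a b = ≤L a b × ≤L b a
  GR a b = ≤R a b × ≤R b a
  GH a b = GL a b × GR a b
  GD a b = ∃[ c ] (Mem c × GL a c × GR c b)
  GJ a b = ≤J a b × ≤J b a

-- Wr d 1 : partial maps of Fin d, as vectors x ↦ xa (nothing = undefined);
--          IS_d is the subset of injective ones.
-- Wr d (suc (suc n)) : an element (f , a) of (Wr d (suc n)) ≀_p IS_d is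
--          stored as the vector x ↦ just (xa , f(x)) for x ∈ dom(a) = dom(f),
--          and x ↦ nothing otherwise.
-- Wr d 0 is an unused placeholder.

Wr : ℕ → ℕ → Set
Wr d zero = ⊤
Wr d (suc zero) = Vec (Maybe (Fin d)) d
Wr d (suc (suc n)) = Vec (Maybe (Fin d × Wr d (suc n))) d

-- multiplication (maps written on the right: x(ab) = (xa)b, (f,a)(g,b) = (f g^a, ab))
-- one step of the wreath-product multiplication, given the multiplication _∙_ of
-- the coefficient semigroup C and the second factor v
wstep : {d : ℕ} {C : Set} → (C → C → C) → Vec (Maybe (Fin d × C)) d
      → Maybe (Fin d × C) → Maybe (Fin d × C)
wstep _∙_ v nothing = nothing
wstep _∙_ v (just (y , s)) with lookup v y
... | nothing = nothing
... | just (z , t) = just (z , (s ∙ t))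

isstep : {d : ℕ} → Vec (Maybe (Fin d)) d → Maybe (Fin d) → Maybe (Fin d)
isstep b nothing  = nothing
isstep b (just y) = lookup b y

mul : (d k : ℕ) → Wr d k → Wr d k → Wr d k
mul d zero u v = tt
mul d (suc zero) a b = tabulate λ x → isstep b (lookup a x)
mul d (suc (suc n)) u v = tabulate λ x → wstep (mul d (suc n)) v (lookup u x)

Mem : (d k : ℕ) → Wr d k → Set
Mem d zero u = ⊤
Mem d (suc zero) a =
  ∀ (x y z : Fin d) → lookup a x ≡ just z → lookup a y ≡ just z → x ≡ y
Mem d (suc (suc n)) u =
  (∀ (x y z : Fin d) (s t : Wr d (suc n)) →
     lookup u x ≡ just (z , s) → lookup u y ≡ just (z , t) → x ≡ y)
  × (∀ (x z : Fin d) (s : Wr d (suc n)) → lookup u x ≡ just (z , s) → Mem d (suc n) s)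

module _ (d k : ℕ) where
  open Green (Wr d k) (Mem d k) (mul d k) public
    using () renaming (GL to 𝓛; GR to 𝓡; GH to 𝓗; GD to 𝓓; GJ to 𝓙)

InDom : (d n : ℕ) → Wr d (suc (suc n)) → Fin d → Set
InDom d n u x = ∃[ y ] ∃[ s ] (lookup u x ≡ just (y , s))

InRan : (d n : ℕ) → Wr d (suc (suc n)) → Fin d → Set
InRan d n u z = ∃[ x ] ∃[ s ] (lookup u x ≡ just (z , s))

{-# OPTIONS --safe #-}
-- Everything is proved for the partial wreath product of an arbitrary monoid with a distinguished
-- submonoid by IS_d, and transferred along the levels by induction (IS_d itself is the wreath
-- product of the trivial monoid by IS_d). L and R are read off pointwise by building the
-- multiplier coordinate by coordinate, and D is obtained by composing them. For D = J: if
-- u = s v t and v = s' u t', then s and s' induce injections dom u → dom v and dom v → dom u along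
-- which the coefficients can only go up in the J-order. Their composite permutes the finite set dom v, so
-- the J-chain closes up along each cycle: the injection dom v → dom u is a bijection matching
-- J-related, hence (by induction) D-related, coefficients.

module Submission where

open import Defs
open import Data.Nat using (ℕ; zero; suc; _<_; _≤_; s≤s)
open import Data.Nat.Properties using (n<1+n)
open import Data.Nat.GeneralisedArithmetic using (fold)
open import Data.Fin using (Fin; toℕ)
open import Data.Fin.Properties using (pigeonhole; any?; _≟_)
open import Data.Vec using (Vec; lookup; tabulate)
open import Data.Vec.Properties using (lookup∘tabulate; tabulate∘lookup; tabulate-cong)
open import Data.Maybe using (Maybe; just; nothing; fromMaybe)
import Data.Maybe as Maybe
open import Data.Maybe.Properties using (just-injective; map-id; map-cong; map-∘; map-just; map-injective)
open import Data.Product using (∃-syntax; Σ-syntax; _×_; _,_; proj₁; proj₂; map₂; swap)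
open import Data.Product.Properties using (,-injectiveˡ; ,-injectiveʳ)
open import Data.Sum using (inj₁; inj₂)
open import Data.Unit using (⊤; tt)
open import Data.Empty using (⊥-elim)
open import Function.Base using (_∘′_)
open import Function.Bundles using (_⇔_; mk⇔; Equivalence)
open import Relation.Nullary using (Dec; yes; no)
open import Relation.Binary.PropositionalEquality

-- The carrier may contain elements outside Mem (e.g. non-injective partial maps); Green's
-- relations are those of Mem, as in Green.
record Submonoid {C : Set} (_·_ : C → C → C) (Mem : C → Set) : Set where
  field
    ε         : C
    assoc     : ∀ a b c → (a · b) · c ≡ a · (b · c)
    identityˡ : ∀ a → ε · a ≡ a
    identityʳ : ∀ a → a · ε ≡ a
    ε∈        : Mem ε
    ·-closed  : ∀ {a b} → Mem a → Mem b → Mem (a · b)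

module GreenProperties {C : Set} {_·_ : C → C → C} {Mem : C → Set}
                       (S : Submonoid _·_ Mem) where
  open Submonoid S
  open Green C Mem _·_ public

  _≤ℒ_ _≤ℛ_ _≤𝒥_ : C → C → Set
  a ≤ℒ b = ∃[ s ] (Mem s × s · b ≡ a)
  a ≤ℛ b = ∃[ s ] (Mem s × b · s ≡ a)
  a ≤𝒥 b = ∃[ s ] ∃[ t ] (Mem s × Mem t × s · (b · t) ≡ a)

  ≤L⇒≤ℒ : ∀ {a b} → ≤L a b → a ≤ℒ b
  ≤L⇒≤ℒ {a} (inj₁ refl) = ε , ε∈ , identityˡ a
  ≤L⇒≤ℒ (inj₂ a≤b)      = a≤b

  ≤R⇒≤ℛ : ∀ {a b} → ≤R a b → a ≤ℛ b
  ≤R⇒≤ℛ {a} (inj₁ refl) = ε , ε∈ , identityʳ a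
  ≤R⇒≤ℛ (inj₂ a≤b)      = a≤b

  private
    fromMaybe-mem : ∀ s → Mem¹ s → Mem (fromMaybe ε s)
    fromMaybe-mem nothing  _   = ε∈
    fromMaybe-mem (just s) s∈ = s∈

    lmul-fromMaybe : ∀ s c → lmul s c ≡ fromMaybe ε s · c
    lmul-fromMaybe nothing  c = sym (identityˡ c)
    lmul-fromMaybe (just s) c = refl

    rmul-fromMaybe : ∀ c t → rmul c t ≡ c · fromMaybe ε t
    rmul-fromMaybe c nothing  = sym (identityʳ c)
    rmul-fromMaybe c (just t) = refl

  ≤J⇒≤𝒥 : ∀ {a b} → ≤J a b → a ≤𝒥 b
  ≤J⇒≤𝒥 {b = b} (s , t , s∈ , t∈ , sbt≡a) =
    fromMaybe ε s , fromMaybe ε t , fromMaybe-mem s s∈ , fromMaybe-mem t t∈ ,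
    trans (sym (trans (lmul-fromMaybe s _) (cong (fromMaybe ε s ·_) (rmul-fromMaybe b t)))) sbt≡a

  ≤𝒥⇒≤J : ∀ {a b} → a ≤𝒥 b → ≤J a b
  ≤𝒥⇒≤J (s , t , s∈ , t∈ , sbt≡a) = just s , just t , s∈ , t∈ , sbt≡a

  ≤𝒥-refl : ∀ {a} → a ≤𝒥 a
  ≤𝒥-refl {a} = ε , ε , ε∈ , ε∈ , trans (identityˡ _) (identityʳ a)

  ≤𝒥-trans : ∀ {a b c} → a ≤𝒥 b → b ≤𝒥 c → a ≤𝒥 c
  ≤𝒥-trans {a} {b} {c} (s , t , s∈ , t∈ , sbt≡a) (s′ , t′ , s′∈ , t′∈ , s′ct′≡b) =
    s · s′ , t′ · t , ·-closed s∈ s′∈ , ·-closed t′∈ t∈ , (begin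
      (s · s′) · (c · (t′ · t)) ≡⟨ assoc s s′ _ ⟩
      s · (s′ · (c · (t′ · t))) ≡⟨ cong (λ z → s · (s′ · z)) (sym (assoc c t′ t)) ⟩
      s · (s′ · ((c · t′) · t)) ≡⟨ cong (s ·_) (sym (assoc s′ _ t)) ⟩
      s · ((s′ · (c · t′)) · t) ≡⟨ cong (λ z → s · (z · t)) s′ct′≡b ⟩
      s · (b · t)               ≡⟨ sbt≡a ⟩
      a                         ∎)
    where open ≡-Reasoning

  GD⇒GJ : ∀ {a b} → GD a b → GJ a b
  GD⇒GJ {a} (c , _ , (a≤c , c≤a) , (c≤b , b≤c))
    with ≤L⇒≤ℒ a≤c | ≤L⇒≤ℒ c≤a | ≤R⇒≤ℛ c≤b | ≤R⇒≤ℛ b≤c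
  ... | s , s∈ , sc≡a | s′ , s′∈ , s′a≡c | t , t∈ , bt≡c | t′ , t′∈ , ct′≡b =
    ≤𝒥⇒≤J (s , t , s∈ , t∈ , trans (cong (s ·_) bt≡c) sc≡a) ,
    ≤𝒥⇒≤J (s′ , t′ , s′∈ , t′∈ ,
           trans (sym (assoc s′ a t′)) (trans (cong (_· t′) s′a≡c) ct′≡b))

record DJSubmonoid {C : Set} (_·_ : C → C → C) (Mem : C → Set) : Set where
  field
    submonoid : Submonoid _·_ Mem
    GJ⇒GD     : ∀ {a b} → Mem a → Mem b → Green.GJ C Mem _·_ a b → Green.GD C Mem _·_ a b

module InjectiveOrbit {d : ℕ} (D : Fin d → Set) (π : Fin d → Fin d)
                      (π-closed : ∀ {x} → D x → D (π x))
                      (π-injective : ∀ {x y} → D x → D y → π x ≡ π y → x ≡ y) where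

  fold-closed : ∀ {x} → D x → ∀ k → D (fold x π k)
  fold-closed Dx zero    = Dx
  fold-closed Dx (suc k) = π-closed (fold-closed Dx k)

  -- two of the first d + 1 points of the orbit coincide, and injectivity cancels back to x
  returns : ∀ {x} → D x → ∃[ m ] (fold x π (suc m) ≡ x)
  returns {x} Dx with pigeonhole (n<1+n d) (λ i → fold x π (toℕ i))
  ... | i , j , i<j , eq = cancel (toℕ i) (toℕ j) i<j eq
    where
    cancel : ∀ a b → a < b → fold x π a ≡ fold x π b → ∃[ m ] (fold x π (suc m) ≡ x)
    cancel _       zero    ()        _
    cancel zero    (suc b) _         eq = b , sym eq
    cancel (suc a) (suc b) (s≤s a<b) eq =
      cancel a b a<b (π-injective (fold-closed Dx a) (fold-closed Dx b) eq)

  module _ {A : Set} (_≲_ : A → A → Set)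
           (≲-refl : ∀ {a} → a ≲ a) (≲-trans : ∀ {a b c} → a ≲ b → b ≲ c → a ≲ c)
           (G : Fin d → A) (step : ∀ {y} → D y → G y ≲ G (π y)) where

    ≲-along-orbit : ∀ {y} → D y → ∀ k → G (π y) ≲ G (fold y π (suc k))
    ≲-along-orbit Dy zero    = ≲-refl
    ≲-along-orbit Dy (suc k) = ≲-trans (≲-along-orbit Dy k) (step (fold-closed Dy (suc k)))

    step-reversed : ∀ {y} → D y → G (π y) ≲ G y
    step-reversed Dy with returns Dy
    ... | m , π¹⁺ᵐy≡y = subst (λ z → G (π _) ≲ G z) π¹⁺ᵐy≡y (≲-along-orbit Dy m)

lookup-ext : ∀ {A : Set} {n} {u v : Vec A n} → (∀ i → lookup u i ≡ lookup v i) → u ≡ v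
lookup-ext {u = u} {v} eq = trans (sym (tabulate∘lookup u)) (trans (tabulate-cong eq) (tabulate∘lookup v))

module _ {A B : Set} where

  mapWith≡ : (m : Maybe A) → (∀ {a} → m ≡ just a → B) → Maybe B
  mapWith≡ nothing  f = nothing
  mapWith≡ (just a) f = just (f refl)

  mapWith≡-just : ∀ {m} (f : ∀ {a} → m ≡ just a → B) {a} (e : m ≡ just a) → mapWith≡ m f ≡ just (f e)
  mapWith≡-just f refl = refl

  mapWith≡-just⁻¹ : ∀ m (f : ∀ {a} → m ≡ just a → B) {b} → mapWith≡ m f ≡ just b →
                    ∃[ a ] Σ[ e ∈ m ≡ just a ] f e ≡ b
  mapWith≡-just⁻¹ (just a) f refl = a , refl , refl

module Wreath (d : ℕ) {C : Set} {_·_ : C → C → C} {Mem : C → Set} (S : Submonoid _·_ Mem) where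
  open Submonoid S

  W : Set
  W = Vec (Maybe (Fin d × C)) d

  _⊙_ : W → W → W
  u ⊙ v = tabulate λ x → wstep _·_ v (lookup u x)

  WMem : W → Set
  WMem u =
    (∀ (x y z : Fin d) (s t : C) → lookup u x ≡ just (z , s) → lookup u y ≡ just (z , t) → x ≡ y)
    × (∀ (x z : Fin d) (s : C) → lookup u x ≡ just (z , s) → Mem s)

  _∈dom_ _∈ran_ : Fin d → W → Set
  x ∈dom u = ∃[ y ] ∃[ s ] (lookup u x ≡ just (y , s))
  z ∈ran u = ∃[ x ] ∃[ s ] (lookup u x ≡ just (z , s))

  lookup-⊙ : ∀ (u v : W) x → lookup (u ⊙ v) x ≡ wstep _·_ v (lookup u x)
  lookup-⊙ u v x = lookup∘tabulate _ x

  wstep-just : ∀ (v : W) y s → wstep _·_ v (just (y , s)) ≡ Maybe.map (map₂ (s ·_)) (lookup v y)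
  wstep-just v y s with lookup v y
  ... | nothing = refl
  ... | just _  = refl

  wstep-just⁻¹ : ∀ (v : W) m {z r} → wstep _·_ v m ≡ just (z , r) →
                 ∃[ y ] ∃[ s ] ∃[ t ] (m ≡ just (y , s) × lookup v y ≡ just (z , t) × s · t ≡ r)
  wstep-just⁻¹ v nothing ()
  wstep-just⁻¹ v (just (y , s)) eq with lookup v y in vy
  wstep-just⁻¹ v (just (y , s)) ()   | nothing
  wstep-just⁻¹ v (just (y , s)) refl | just (z , t) = y , s , t , refl , vy , refl

  wstep-hit : ∀ (v : W) y {z s t} → lookup v y ≡ just (z , t) → wstep _·_ v (just (y , s)) ≡ just (z , s · t)
  wstep-hit v y {s = s} vy = trans (wstep-just v y s) (map-just vy)

  ⊙-just⁻¹ : ∀ (u v : W) x {z r} → lookup (u ⊙ v) x ≡ just (z , r) →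
             ∃[ y ] ∃[ s ] ∃[ t ] (lookup u x ≡ just (y , s) × lookup v y ≡ just (z , t) × s · t ≡ r)
  ⊙-just⁻¹ u v x eq = wstep-just⁻¹ v (lookup u x) (trans (sym (lookup-⊙ u v x)) eq)

  ι : W
  ι = tabulate λ x → just (x , ε)

  lookup-ι : ∀ x → lookup ι x ≡ just (x , ε)
  lookup-ι x = lookup∘tabulate _ x

  ⊙-identityˡ : ∀ (u : W) → ι ⊙ u ≡ u
  ⊙-identityˡ u = lookup-ext λ x → begin
    lookup (ι ⊙ u) x                      ≡⟨ lookup-⊙ ι u x ⟩
    wstep _·_ u (lookup ι x)              ≡⟨ cong (wstep _·_ u) (lookup-ι x) ⟩
    wstep _·_ u (just (x , ε))            ≡⟨ wstep-just u x ε ⟩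
    Maybe.map (map₂ (ε ·_)) (lookup u x)  ≡⟨ map-cong (λ (z , t) → cong (z ,_) (identityˡ t)) (lookup u x) ⟩
    Maybe.map (λ p → p) (lookup u x)      ≡⟨ map-id (lookup u x) ⟩
    lookup u x                            ∎
    where open ≡-Reasoning

  ⊙-identityʳ : ∀ (u : W) → u ⊙ ι ≡ u
  ⊙-identityʳ u = lookup-ext λ x → trans (lookup-⊙ u ι x) (wstep-ι (lookup u x))
    where
    wstep-ι : ∀ m → wstep _·_ ι m ≡ m
    wstep-ι nothing        = refl
    wstep-ι (just (y , s)) = trans (wstep-just ι y s)
      (trans (map-just (lookup-ι y)) (cong (λ r → just (y , r)) (identityʳ s)))

  wstep-map : ∀ (w : W) s m → wstep _·_ w (Maybe.map (map₂ (s ·_)) m) ≡ Maybe.map (map₂ (s ·_)) (wstep _·_ w m)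
  wstep-map w s nothing        = refl
  wstep-map w s (just (z , t)) = begin
    wstep _·_ w (just (z , s · t))
      ≡⟨ wstep-just w z (s · t) ⟩
    Maybe.map (map₂ ((s · t) ·_)) (lookup w z)
      ≡⟨ map-cong (λ (q , r) → cong (q ,_) (assoc s t r)) (lookup w z) ⟩
    Maybe.map (map₂ (s ·_) ∘′ map₂ (t ·_)) (lookup w z)
      ≡⟨ map-∘ (lookup w z) ⟩
    Maybe.map (map₂ (s ·_)) (Maybe.map (map₂ (t ·_)) (lookup w z))
      ≡⟨ cong (Maybe.map (map₂ (s ·_))) (wstep-just w z t) ⟨
    Maybe.map (map₂ (s ·_)) (wstep _·_ w (just (z , t)))
      ∎
    where open ≡-Reasoning

  ⊙-assoc : ∀ (u v w : W) → (u ⊙ v) ⊙ w ≡ u ⊙ (v ⊙ w)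
  ⊙-assoc u v w = lookup-ext λ x → begin
    lookup ((u ⊙ v) ⊙ w) x                  ≡⟨ lookup-⊙ (u ⊙ v) w x ⟩
    wstep _·_ w (lookup (u ⊙ v) x)          ≡⟨ cong (wstep _·_ w) (lookup-⊙ u v x) ⟩
    wstep _·_ w (wstep _·_ v (lookup u x))  ≡⟨ wstep-wstep (lookup u x) ⟩
    wstep _·_ (v ⊙ w) (lookup u x)          ≡⟨ lookup-⊙ u (v ⊙ w) x ⟨
    lookup (u ⊙ (v ⊙ w)) x                  ∎
    where
    open ≡-Reasoning
    wstep-wstep : ∀ m → wstep _·_ w (wstep _·_ v m) ≡ wstep _·_ (v ⊙ w) m
    wstep-wstep nothing        = refl
    wstep-wstep (just (y , s)) = begin
      wstep _·_ w (wstep _·_ v (just (y , s)))                ≡⟨ cong (wstep _·_ w) (wstep-just v y s) ⟩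
      wstep _·_ w (Maybe.map (map₂ (s ·_)) (lookup v y))      ≡⟨ wstep-map w s (lookup v y) ⟩
      Maybe.map (map₂ (s ·_)) (wstep _·_ w (lookup v y))      ≡⟨ cong (Maybe.map (map₂ (s ·_))) (lookup-⊙ v w y) ⟨
      Maybe.map (map₂ (s ·_)) (lookup (v ⊙ w) y)              ≡⟨ wstep-just (v ⊙ w) y s ⟨
      wstep _·_ (v ⊙ w) (just (y , s))                        ∎

  ⊙-closed : ∀ {u v : W} → WMem u → WMem v → WMem (u ⊙ v)
  ⊙-closed {u} {v} (u-inj , u-mem) (v-inj , v-mem) = injective , members
    where
    injective : ∀ x x′ z s t → lookup (u ⊙ v) x ≡ just (z , s) → lookup (u ⊙ v) x′ ≡ just (z , t) → x ≡ x′
    injective x x′ z _ _ e e′ with ⊙-just⁻¹ u v x e | ⊙-just⁻¹ u v x′ e′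
    ... | y , s , t , ux , vy , _ | y′ , s′ , t′ , ux′ , vy′ , _ with v-inj y y′ z t t′ vy vy′
    ... | refl = u-inj x x′ y s s′ ux ux′
    members : ∀ x z r → lookup (u ⊙ v) x ≡ just (z , r) → Mem r
    members x z r e with ⊙-just⁻¹ u v x e
    ... | y , s , t , ux , vy , refl = ·-closed (u-mem x y s ux) (v-mem y z t vy)

  ι∈ : WMem ι
  ι∈ = (λ x y z s t ιx ιy → trans (,-injectiveˡ (just-injective (trans (sym (lookup-ι x)) ιx)))
                                  (sym (,-injectiveˡ (just-injective (trans (sym (lookup-ι y)) ιy))))) ,
       (λ x z s ιx → subst Mem (,-injectiveʳ (just-injective (trans (sym (lookup-ι x)) ιx))) ε∈)

  ≀-submonoid : Submonoid _⊙_ WMem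
  ≀-submonoid = record
    { ε = ι ; assoc = ⊙-assoc ; identityˡ = ⊙-identityˡ ; identityʳ = ⊙-identityʳ
    ; ε∈ = ι∈ ; ·-closed = λ {u} {v} → ⊙-closed {u} {v} }

  open GreenProperties S
  module ≀ = GreenProperties ≀-submonoid
  open Equivalence

  lookup-cong : ∀ {u u′ : W} → u ≡ u′ → ∀ x → lookup u x ≡ lookup u′ x
  lookup-cong refl x = refl

  wstep-mapWith≡ : ∀ (v : W) m (f : ∀ {a} → m ≡ just a → Fin d × C) →
                   (∀ {a} (e : m ≡ just a) → wstep _·_ v (just (f e)) ≡ just a) →
                   wstep _·_ v (mapWith≡ m f) ≡ m
  wstep-mapWith≡ v nothing  f _    = refl
  wstep-mapWith≡ v (just a) f step = step refl

  ≤ℒ⇒ran⊆ : ∀ {u v z} → u ≀.≤ℒ v → z ∈ran u → z ∈ran v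
  ≤ℒ⇒ran⊆ {u} {v} (w , _ , wv≡u) (x , _ , ux) with ⊙-just⁻¹ w v x (trans (lookup-cong wv≡u x) ux)
  ... | y , _ , t , _ , vy , _ = y , t , vy

  ≤ℒ⇒≤ℒ-coefficients : ∀ {u v} → WMem v → u ≀.≤ℒ v → ∀ {x y z s t} →
                       lookup u x ≡ just (z , s) → lookup v y ≡ just (z , t) → s ≤ℒ t
  ≤ℒ⇒≤ℒ-coefficients {u} {v} (v-inj , _) (w , (_ , w-mem) , wv≡u) {x} {y} ux vy
    with ⊙-just⁻¹ w v x (trans (lookup-cong wv≡u x) ux)
  ... | y′ , h , t′ , wx , vy′ , ht′≡s with v-inj y′ y _ t′ _ vy′ vy
  ... | refl with just-injective (trans (sym vy′) vy)
  ... | refl = h , w-mem x y′ h wx , ht′≡s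

  ran⊆⇒≤ℒ : ∀ {u v} → WMem u → (∀ {z} → z ∈ran u → z ∈ran v) →
            (∀ {x y z s t} → lookup u x ≡ just (z , s) → lookup v y ≡ just (z , t) → s ≤ℒ t) →
            u ≀.≤ℒ v
  ran⊆⇒≤ℒ {u} {v} (u-inj , _) ran⊆ ≤ℒ-coefficients = w , (w-inj , w-mem) , wv≡u
    where
    witness : ∀ {x z s} → lookup u x ≡ just (z , s) →
              Σ[ (y , h) ∈ Fin d × C ] ∃[ t ] (lookup v y ≡ just (z , t) × Mem h × h · t ≡ s)
    witness {x} {s = s} ux with ran⊆ (x , s , ux)
    ... | y , t , vy with ≤ℒ-coefficients ux vy
    ... | h , h∈ , ht≡s = (y , h) , t , vy , h∈ , ht≡s

    w : W
    w = tabulate λ x → mapWith≡ (lookup u x) (λ ux → proj₁ (witness ux))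

    w-spec : ∀ {x y h} → lookup w x ≡ just (y , h) →
             ∃[ z ] ∃[ s ] ∃[ t ] (lookup u x ≡ just (z , s) × lookup v y ≡ just (z , t) × Mem h)
    w-spec {x} wx with mapWith≡-just⁻¹ (lookup u x) _ (trans (sym (lookup∘tabulate _ x)) wx)
    ... | (z , s) , ux , refl = let (_ , t , vy , h∈ , _) = witness ux in z , s , t , ux , vy , h∈

    w-inj : ∀ x x′ y h h′ → lookup w x ≡ just (y , h) → lookup w x′ ≡ just (y , h′) → x ≡ x′
    w-inj x x′ _ _ _ wx wx′ with w-spec wx | w-spec wx′
    ... | z , s , _ , ux , vy , _ | z′ , s′ , _ , ux′ , vy′ , _ with just-injective (trans (sym vy) vy′)
    ... | refl = u-inj x x′ z s s′ ux ux′

    w-mem : ∀ x y h → lookup w x ≡ just (y , h) → Mem h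
    w-mem _ _ _ wx = let (_ , _ , _ , _ , _ , h∈) = w-spec wx in h∈

    wv≡u : w ⊙ v ≡ u
    wv≡u = lookup-ext λ x → begin
      lookup (w ⊙ v) x                                          ≡⟨ lookup-⊙ w v x ⟩
      wstep _·_ v (lookup w x)                                  ≡⟨ cong (wstep _·_ v) (lookup∘tabulate _ x) ⟩
      wstep _·_ v (mapWith≡ (lookup u x) (λ ux → proj₁ (witness ux))) ≡⟨ wstep-mapWith≡ v (lookup u x) _ step ⟩
      lookup u x                                                ∎
      where
      open ≡-Reasoning
      step : ∀ {x a} (ux : lookup u x ≡ just a) → wstep _·_ v (just (proj₁ (witness ux))) ≡ just a
      step ux = let (_ , _ , vy , _ , ht≡s) = witness ux in
        trans (wstep-hit v _ vy) (cong (λ r → just (_ , r)) ht≡s)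

  ≤ℛ⇒dom⊆ : ∀ {u v x} → u ≀.≤ℛ v → x ∈dom u → x ∈dom v
  ≤ℛ⇒dom⊆ {u} {v} {x} (w , _ , vw≡u) (_ , _ , ux) with ⊙-just⁻¹ v w x (trans (lookup-cong vw≡u x) ux)
  ... | y , t , _ , vx , _ , _ = y , t , vx

  ≤ℛ⇒≤ℛ-coefficients : ∀ {u v} → u ≀.≤ℛ v → ∀ {x y₁ y₂ s t} →
                       lookup u x ≡ just (y₁ , s) → lookup v x ≡ just (y₂ , t) → s ≤ℛ t
  ≤ℛ⇒≤ℛ-coefficients {u} {v} (w , (_ , w-mem) , vw≡u) {x} {y₁} ux vx
    with ⊙-just⁻¹ v w x (trans (lookup-cong vw≡u x) ux)
  ... | y , t′ , h , vx′ , wy , t′h≡s with just-injective (trans (sym vx′) vx)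
  ... | refl = h , w-mem y y₁ h wy , t′h≡s

  _∈ran?_ : ∀ y v → Dec (y ∈ran v)
  y ∈ran? v = any? λ x → hits (lookup v x)
    where
    hits : ∀ m → Dec (∃[ t ] (m ≡ just (y , t)))
    hits nothing = no λ ()
    hits (just (y′ , t)) with y′ ≟ y
    ... | yes refl = yes (t , refl)
    ... | no y′≢y  = no λ (_ , eq) → y′≢y (,-injectiveˡ (just-injective eq))

  dom⊆⇒≤ℛ : ∀ {u v} → WMem u → WMem v →
            (∀ {x} → x ∈dom u → x ∈dom v) → (∀ {x} → x ∈dom v → x ∈dom u) →
            (∀ {x y₁ y₂ s t} → lookup u x ≡ just (y₁ , s) → lookup v x ≡ just (y₂ , t) → s ≤ℛ t) →
            u ≀.≤ℛ v
  dom⊆⇒≤ℛ {u} {v} (u-inj , _) (v-inj , _) dom⊆ dom⊇ ≤ℛ-coefficients = w , (w-inj , w-mem) , vw≡u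
    where
    witness : ∀ {y} → y ∈ran v →
              Σ[ (y₁ , h) ∈ Fin d × C ] ∃[ x ] ∃[ s ] ∃[ t ]
                (lookup v x ≡ just (y , t) × lookup u x ≡ just (y₁ , s) × Mem h × t · h ≡ s)
    witness {y} (x , t , vx) with dom⊇ (y , t , vx)
    ... | y₁ , s , ux with ≤ℛ-coefficients ux vx
    ... | h , h∈ , th≡s = (y₁ , h) , x , s , t , vx , ux , h∈ , th≡s

    w-at : ∀ y → Dec (y ∈ran v) → Maybe (Fin d × C)
    w-at y (yes y∈) = just (proj₁ (witness y∈))
    w-at y (no _)   = nothing

    w : W
    w = tabulate λ y → w-at y (y ∈ran? v)

    w-spec : ∀ {y y₁ h} → lookup w y ≡ just (y₁ , h) → ∃[ x ] ∃[ s ] ∃[ t ]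
               (lookup v x ≡ just (y , t) × lookup u x ≡ just (y₁ , s) × Mem h)
    w-spec {y} wy = spec (y ∈ran? v) (trans (sym (lookup∘tabulate _ y)) wy)
      where
      spec : ∀ {y₁ h} D → w-at y D ≡ just (y₁ , h) → ∃[ x ] ∃[ s ] ∃[ t ]
               (lookup v x ≡ just (y , t) × lookup u x ≡ just (y₁ , s) × Mem h)
      spec (yes y∈) refl = let (_ , x , s , t , vx , ux , h∈ , _) = witness y∈ in x , s , t , vx , ux , h∈

    w-inj : ∀ y y′ y₁ h h′ → lookup w y ≡ just (y₁ , h) → lookup w y′ ≡ just (y₁ , h′) → y ≡ y′
    w-inj _ _ y₁ _ _ wy wy′ with w-spec wy | w-spec wy′
    ... | x , s , _ , vx , ux , _ | x′ , s′ , _ , vx′ , ux′ , _ with u-inj x x′ y₁ s s′ ux ux′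
    ... | refl = ,-injectiveˡ (just-injective (trans (sym vx) vx′))

    w-mem : ∀ y y₁ h → lookup w y ≡ just (y₁ , h) → Mem h
    w-mem _ _ _ wy = let (_ , _ , _ , _ , _ , h∈) = w-spec wy in h∈

    w-at-image : ∀ {x y t} → lookup v x ≡ just (y , t) → ∀ D →
                 ∃[ y₁ ] ∃[ h ] (w-at y D ≡ just (y₁ , h) × lookup u x ≡ just (y₁ , t · h))
    w-at-image {x} vx (no y∉) = ⊥-elim (y∉ (x , _ , vx))
    w-at-image {x} {y} vx (yes y∈@(x′ , t′ , vx′)) with v-inj x′ x y t′ _ vx′ vx
    ... | refl with just-injective (trans (sym vx′) vx)
    ... | refl = let ((y₁ , h) , _ , _ , _ , _ , ux , _ , th≡s) = witness y∈ in
                 y₁ , h , refl , trans ux (cong (λ r → just (y₁ , r)) (sym th≡s))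

    vw≡u : v ⊙ w ≡ u
    vw≡u = lookup-ext λ x → trans (lookup-⊙ v w x) (at x (lookup v x) refl)
      where
      at : ∀ x m → lookup v x ≡ m → wstep _·_ w m ≡ lookup u x
      at x nothing vx with lookup u x in ux
      ... | nothing = refl
      ... | just (y₁ , s) with () ← trans (sym vx) (proj₂ (proj₂ (dom⊆ (y₁ , s , ux))))
      at x (just (y , t)) vx =
        let (_ , _ , wy , ux) = w-at-image vx (y ∈ran? v) in
        trans (wstep-hit w y (trans (lookup∘tabulate _ y) wy)) (sym ux)

  SameRan SameDom LCompatible RCompatible : W → W → Set
  SameRan u v = ∀ z → z ∈ran u ⇔ z ∈ran v
  SameDom u v = ∀ x → x ∈dom u ⇔ x ∈dom v
  LCompatible u v = ∀ (z x y : Fin d) (s t : C) →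
    lookup u x ≡ just (z , s) → lookup v y ≡ just (z , t) → GL t s
  RCompatible u v = ∀ (x y₁ y₂ : Fin d) (s t : C) →
    lookup u x ≡ just (y₁ , s) → lookup v x ≡ just (y₂ , t) → GR s t

  GL⇔ : ∀ {u v} → WMem u → WMem v → ≀.GL u v ⇔ (SameRan u v × LCompatible u v)
  GL⇔ {u} {v} u∈ v∈ = mk⇔
    (λ (u≤v , v≤u) →
      (λ z → mk⇔ (≤ℒ⇒ran⊆ {u} {v} (≀.≤L⇒≤ℒ u≤v)) (≤ℒ⇒ran⊆ {v} {u} (≀.≤L⇒≤ℒ v≤u))) ,
      (λ _ _ _ _ _ ux vy → inj₂ (≤ℒ⇒≤ℒ-coefficients {v} {u} u∈ (≀.≤L⇒≤ℒ v≤u) vy ux) ,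
                           inj₂ (≤ℒ⇒≤ℒ-coefficients {u} {v} v∈ (≀.≤L⇒≤ℒ u≤v) ux vy)))
    (λ (ran , compatible) →
      inj₂ (ran⊆⇒≤ℒ {u} {v} u∈ (to (ran _)) (λ ux vy → ≤L⇒≤ℒ (proj₂ (compatible _ _ _ _ _ ux vy)))) ,
      inj₂ (ran⊆⇒≤ℒ {v} {u} v∈ (from (ran _)) (λ vy ux → ≤L⇒≤ℒ (proj₁ (compatible _ _ _ _ _ ux vy)))))

  GR⇔ : ∀ {u v} → WMem u → WMem v → ≀.GR u v ⇔ (SameDom u v × RCompatible u v)
  GR⇔ {u} {v} u∈ v∈ = mk⇔
    (λ (u≤v , v≤u) →
      (λ x → mk⇔ (≤ℛ⇒dom⊆ {u} {v} (≀.≤R⇒≤ℛ u≤v)) (≤ℛ⇒dom⊆ {v} {u} (≀.≤R⇒≤ℛ v≤u))) ,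
      (λ _ _ _ _ _ ux vx → inj₂ (≤ℛ⇒≤ℛ-coefficients {u} {v} (≀.≤R⇒≤ℛ u≤v) ux vx) ,
                           inj₂ (≤ℛ⇒≤ℛ-coefficients {v} {u} (≀.≤R⇒≤ℛ v≤u) vx ux)))
    (λ (dom , compatible) →
      inj₂ (dom⊆⇒≤ℛ {u} {v} u∈ v∈ (to (dom _)) (from (dom _))
              (λ ux vx → ≤R⇒≤ℛ (proj₁ (compatible _ _ _ _ _ ux vx)))) ,
      inj₂ (dom⊆⇒≤ℛ {v} {u} v∈ u∈ (from (dom _)) (to (dom _))
              (λ vx ux → ≤R⇒≤ℛ (proj₂ (compatible _ _ _ _ _ ux vx)))))

  GH⇔ : ∀ {u v} → WMem u → WMem v →
        ≀.GH u v ⇔ (SameRan u v × SameDom u v × LCompatible u v × RCompatible u v)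
  GH⇔ u∈ v∈ = mk⇔
    (λ (uLv , uRv) → let (ran , Lc) = to (GL⇔ u∈ v∈) uLv ; (dom , Rc) = to (GR⇔ u∈ v∈) uRv in
                     ran , dom , Lc , Rc)
    (λ (ran , dom , Lc , Rc) → from (GL⇔ u∈ v∈) (ran , Lc) , from (GR⇔ u∈ v∈) (dom , Rc))

  DMatching : W → W → Set
  DMatching u v = Σ[ χ ∈ (Fin d → Fin d) ]
    ((∀ (z : Fin d) → z ∈dom v → χ z ∈dom u) ×
     (∀ z z′ → z ∈dom v → z′ ∈dom v → χ z ≡ χ z′ → z ≡ z′) ×
     (∀ y → y ∈dom u → ∃[ z ] (z ∈dom v × χ z ≡ y)) ×
     (∀ (z p q : Fin d) (s t : C) → lookup v z ≡ just (q , t) → lookup u (χ z) ≡ just (p , s) → GD s t))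

  DMatching-through : ∀ {u c v} → WMem u → WMem c → SameRan u c → LCompatible u c →
                      SameDom c v → RCompatible c v → DMatching u v
  DMatching-through {u} {c} {v} (u-inj , _) (c-inj , c-mem) ran Lc dom Rc =
    χ , χ-dom , χ-inj , χ-onto , χ-coefficients
    where
    -- zχ is the point of dom u with the same image under u as z under c
    preimage : ∀ {z w r} → lookup c z ≡ just (w , r) → Fin d
    preimage {z} cz = proj₁ (from (ran _) (z , _ , cz))

    χ : Fin d → Fin d
    χ z = fromMaybe z (mapWith≡ (lookup c z) preimage)

    χ-spec : ∀ {z w r} → lookup c z ≡ just (w , r) → ∃[ s ] (lookup u (χ z) ≡ just (w , s))
    χ-spec {z} {w} cz = let (s , u·) = proj₂ (from (ran _) (z , _ , cz)) in
      s , subst (λ x → lookup u x ≡ just (w , s)) (sym (cong (fromMaybe z) (mapWith≡-just preimage cz))) u·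

    χ-dom : ∀ z → z ∈dom v → χ z ∈dom u
    χ-dom z z∈ = let (w , _ , cz) = from (dom z) z∈ ; (s , uχz) = χ-spec cz in w , s , uχz

    χ-inj : ∀ z z′ → z ∈dom v → z′ ∈dom v → χ z ≡ χ z′ → z ≡ z′
    χ-inj z z′ z∈ z′∈ χz≡χz′ with from (dom z) z∈ | from (dom z′) z′∈
    ... | w , r , cz | w′ , r′ , cz′ with χ-spec cz | χ-spec cz′
    ... | _ , uχz | _ , uχz′ with just-injective (trans (sym uχz) (trans (cong (lookup u) χz≡χz′) uχz′))
    ... | refl = c-inj z z′ w r r′ cz cz′

    χ-onto : ∀ y → y ∈dom u → ∃[ z ] (z ∈dom v × χ z ≡ y)
    χ-onto y (w , s , uy) with to (ran w) (y , s , uy)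
    ... | z , r , cz = let (s′ , uχz) = χ-spec cz in z , to (dom z) (w , r , cz) , u-inj (χ z) y w s′ s uχz uy

    χ-coefficients : ∀ (z p q : Fin d) (s t : C) →
                     lookup v z ≡ just (q , t) → lookup u (χ z) ≡ just (p , s) → GD s t
    χ-coefficients z p q s t vz uχz with from (dom z) (q , t , vz)
    ... | w , r , cz with χ-spec cz
    ... | s′ , uχz′ with just-injective (trans (sym uχz) uχz′)
    ... | refl = r , c-mem z w r cz , swap (Lc w (χ z) z s r uχz cz) , Rc z w q r t cz vz

  DMatching⇒GD : ∀ {u v} → WMem u → WMem v → DMatching u v → ≀.GD u v
  DMatching⇒GD {u} {v} u∈@(u-inj , _) v∈ (χ , χ-dom , χ-inj , χ-onto , χ-coefficients) =
    c , c∈ , from (GL⇔ u∈ c∈) (ran , Lc) , from (GR⇔ c∈ v∈) (dom , Rc)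
    where
    witness : ∀ {z q t} → lookup v z ≡ just (q , t) →
              Σ[ (p , r) ∈ Fin d × C ] ∃[ s ] (lookup u (χ z) ≡ just (p , s) × Mem r × GL s r × GR r t)
    witness {z} {q} {t} vz with χ-dom z (q , t , vz)
    ... | p , s , uχz with χ-coefficients z p q s t vz uχz
    ... | r , r∈ , sLr , rRt = (p , r) , s , uχz , r∈ , sLr , rRt

    c : W
    c = tabulate λ z → mapWith≡ (lookup v z) (λ vz → proj₁ (witness vz))

    c-spec : ∀ {z p r} → lookup c z ≡ just (p , r) → ∃[ q ] ∃[ t ] ∃[ s ]
               (lookup v z ≡ just (q , t) × lookup u (χ z) ≡ just (p , s) × Mem r × GL s r × GR r t)
    c-spec {z} cz with mapWith≡-just⁻¹ (lookup v z) _ (trans (sym (lookup∘tabulate _ z)) cz)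
    ... | (q , t) , vz , refl = let (_ , s , uχz , r∈ , sLr , rRt) = witness vz in q , t , s , vz , uχz , r∈ , sLr , rRt

    c-dom : ∀ {z} → z ∈dom v → z ∈dom c
    c-dom {z} (q , t , vz) = _ , _ , trans (lookup∘tabulate _ z) (mapWith≡-just _ vz)

    c∈ : WMem c
    c∈ = c-inj , c-mem
      where
      c-inj : ∀ z z′ p r r′ → lookup c z ≡ just (p , r) → lookup c z′ ≡ just (p , r′) → z ≡ z′
      c-inj z z′ p _ _ cz cz′ with c-spec cz | c-spec cz′
      ... | q , t , s , vz , uχz , _ | q′ , t′ , s′ , vz′ , uχz′ , _ =
        χ-inj z z′ (q , t , vz) (q′ , t′ , vz′) (u-inj (χ z) (χ z′) p s s′ uχz uχz′)
      c-mem : ∀ z p r → lookup c z ≡ just (p , r) → Mem r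
      c-mem _ _ _ cz = let (_ , _ , _ , _ , _ , r∈ , _) = c-spec cz in r∈

    ran : SameRan u c
    ran p = mk⇔ ran⊆ ran⊇
      where
      ran⊆ : p ∈ran u → p ∈ran c
      ran⊆ (x , s , ux) with χ-onto x (p , s , ux)
      ... | z , z∈ , refl with c-dom z∈
      ... | p′ , r , cz with c-spec cz
      ... | _ , _ , _ , _ , uχz , _ with just-injective (trans (sym ux) uχz)
      ... | refl = z , r , cz
      ran⊇ : p ∈ran c → p ∈ran u
      ran⊇ (z , r , cz) = let (_ , _ , s , _ , uχz , _) = c-spec cz in χ z , s , uχz

    Lc : LCompatible u c
    Lc p x z s r ux cz with c-spec cz
    ... | _ , _ , s′ , _ , uχz , _ , s′Lr , _ with u-inj (χ z) x p s′ s uχz ux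
    ... | refl with just-injective (trans (sym uχz) ux)
    ... | refl = swap s′Lr

    dom : SameDom c v
    dom x = mk⇔ (λ (_ , _ , cx) → let (q , t , _ , vx , _) = c-spec cx in q , t , vx) c-dom

    Rc : RCompatible c v
    Rc x y₁ y₂ r t cx vx with c-spec cx
    ... | _ , _ , _ , vx′ , _ , _ , _ , rRt′ with just-injective (trans (sym vx′) vx)
    ... | refl = rRt′

  GD⇔ : ∀ {u v} → WMem u → WMem v → ≀.GD u v ⇔ DMatching u v
  GD⇔ {u} {v} u∈ v∈ = mk⇔
    (λ (c , c∈ , uLc , cRv) → let (ran , Lc) = to (GL⇔ u∈ c∈) uLc ; (dom , Rc) = to (GR⇔ c∈ v∈) cRv in
                              DMatching-through {u} {c} {v} u∈ c∈ ran Lc dom Rc)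
    (DMatching⇒GD u∈ v∈)

  -- default values outside the domain; only ever read at points of the domain
  target : W → Fin d → Fin d
  target s x = fromMaybe x (Maybe.map proj₁ (lookup s x))

  coefficient : W → Fin d → C
  coefficient u x = fromMaybe ε (Maybe.map proj₂ (lookup u x))

  module ≤𝒥-transport {u v s t : W} (s∈ : WMem s) (t∈ : WMem t)
                      (svt≡u : s ⊙ (v ⊙ t) ≡ u) where

    σ : Fin d → Fin d
    σ = target s

    decompose : ∀ {x} → x ∈dom u →
                ∃[ h ] (lookup s x ≡ just (σ x , h) × σ x ∈dom v × coefficient u x ≤𝒥 coefficient v (σ x))
    decompose {x} (z , f , ux) with ⊙-just⁻¹ s (v ⊙ t) x (trans (lookup-cong svt≡u x) ux)
    ... | y , h , r , sx , vty , hr≡f with ⊙-just⁻¹ v t y vty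
    ... | y′ , g , k , vy , ty′ , gk≡r rewrite sx | ux | vy =
      h , refl , (y′ , g , refl) ,
      h , k , proj₂ s∈ x y h sx , proj₂ t∈ y′ z k ty′ , trans (cong (h ·_) gk≡r) hr≡f

    σ-dom : ∀ {x} → x ∈dom u → σ x ∈dom v
    σ-dom x∈ = let (_ , _ , σx∈ , _) = decompose x∈ in σx∈

    σ-≤𝒥 : ∀ {x} → x ∈dom u → coefficient u x ≤𝒥 coefficient v (σ x)
    σ-≤𝒥 x∈ = let (_ , _ , _ , ≤𝒥) = decompose x∈ in ≤𝒥

    σ-inj : ∀ {x x′} → x ∈dom u → x′ ∈dom u → σ x ≡ σ x′ → x ≡ x′
    σ-inj {x} {x′} x∈ x′∈ σx≡σx′ with decompose x∈ | decompose x′∈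
    ... | h , sx , _ | h′ , sx′ , _ =
      proj₁ s∈ x x′ (σ x′) h h′ (subst (λ y → lookup s x ≡ just (y , h)) σx≡σx′ sx) sx′

  GJ⇒GD : (∀ {a b} → Mem a → Mem b → GJ a b → GD a b) →
          ∀ {u v} → WMem u → WMem v → ≀.GJ u v → ≀.GD u v
  GJ⇒GD coefficient-GJ⇒GD {u} {v} u∈@(_ , u-mem) v∈@(_ , v-mem) (u≤v , v≤u)
    with ≀.≤J⇒≤𝒥 u≤v | ≀.≤J⇒≤𝒥 v≤u
  ... | s , t , s∈ , t∈ , svt≡u | s′ , t′ , s′∈ , t′∈ , s′ut′≡v =
    from (GD⇔ u∈ v∈) (β , (λ _ → B.σ-dom) , (λ _ _ → B.σ-inj) , β-onto , β-coefficients)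
    where
    module A = ≤𝒥-transport {u} {v} {s} {t} s∈ t∈ svt≡u
    module B = ≤𝒥-transport {v} {u} {s′} {t′} s′∈ t′∈ s′ut′≡v
    β : Fin d → Fin d
    β = B.σ

    -- A.σ ∘ β permutes dom v, so the ≤𝒥-chain along each of its orbits closes up
    module V = InjectiveOrbit (_∈dom v) (A.σ ∘′ β) (λ z∈ → A.σ-dom (B.σ-dom z∈))
                 (λ z∈ z′∈ eq → B.σ-inj z∈ z′∈ (A.σ-inj (B.σ-dom z∈) (B.σ-dom z′∈) eq))
    module U = InjectiveOrbit (_∈dom u) (β ∘′ A.σ) (λ x∈ → B.σ-dom (A.σ-dom x∈))
                 (λ x∈ x′∈ eq → A.σ-inj x∈ x′∈ (B.σ-inj (A.σ-dom x∈) (A.σ-dom x′∈) eq))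

    β-onto : ∀ x → x ∈dom u → ∃[ z ] (z ∈dom v × β z ≡ x)
    β-onto x x∈ = let (m , eq) = U.returns x∈ in A.σ (fold x (β ∘′ A.σ) m) , A.σ-dom (U.fold-closed x∈ m) , eq

    β-≥𝒥 : ∀ {z} → z ∈dom v → coefficient u (β z) ≤𝒥 coefficient v z
    β-≥𝒥 z∈ = ≤𝒥-trans (A.σ-≤𝒥 (B.σ-dom z∈))
      (V.step-reversed _≤𝒥_ ≤𝒥-refl ≤𝒥-trans (coefficient v)
        (λ z∈ → ≤𝒥-trans (B.σ-≤𝒥 z∈) (A.σ-≤𝒥 (B.σ-dom z∈))) z∈)

    β-coefficients : ∀ (z p q : Fin d) (s t : C) →
                     lookup v z ≡ just (q , t) → lookup u (β z) ≡ just (p , s) → GD s t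
    β-coefficients z p q s t vz uβz = coefficient-GJ⇒GD (u-mem (β z) p s uβz) (v-mem z q t vz)
      (≤𝒥⇒≤J (subst₂ _≤𝒥_ uβz-coefficient vz-coefficient (β-≥𝒥 z∈)) ,
       ≤𝒥⇒≤J (subst₂ _≤𝒥_ vz-coefficient uβz-coefficient (B.σ-≤𝒥 z∈)))
      where
      z∈ : z ∈dom v
      z∈ = q , t , vz
      uβz-coefficient : coefficient u (β z) ≡ s
      uβz-coefficient = cong (fromMaybe ε ∘′ Maybe.map proj₂) uβz
      vz-coefficient : coefficient v z ≡ t
      vz-coefficient = cong (fromMaybe ε ∘′ Maybe.map proj₂) vz

module GreenHomomorphism {C₁ C₂ : Set} {_·₁_ : C₁ → C₁ → C₁} {_·₂_ : C₂ → C₂ → C₂}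
                         {Mem₁ : C₁ → Set} {Mem₂ : C₂ → Set}
                         (S₁ : Submonoid _·₁_ Mem₁) (S₂ : Submonoid _·₂_ Mem₂)
                         (f : C₁ → C₂) (f-hom : ∀ a b → f (a ·₁ b) ≡ f a ·₂ f b)
                         (f-mem : ∀ {a} → Mem₁ a → Mem₂ (f a)) where
  module G₁ = GreenProperties S₁
  module G₂ = GreenProperties S₂

  GL-map : ∀ {a b} → G₁.GL a b → G₂.GL (f a) (f b)
  GL-map (a≤b , b≤a) = ≤L-map a≤b , ≤L-map b≤a
    where
    ≤L-map : ∀ {a b} → G₁.≤L a b → G₂.≤L (f a) (f b)
    ≤L-map a≤b with G₁.≤L⇒≤ℒ a≤b
    ... | s , s∈ , sb≡a = inj₂ (f s , f-mem s∈ , trans (sym (f-hom s _)) (cong f sb≡a))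

  GR-map : ∀ {a b} → G₁.GR a b → G₂.GR (f a) (f b)
  GR-map (a≤b , b≤a) = ≤R-map a≤b , ≤R-map b≤a
    where
    ≤R-map : ∀ {a b} → G₁.≤R a b → G₂.≤R (f a) (f b)
    ≤R-map a≤b with G₁.≤R⇒≤ℛ a≤b
    ... | s , s∈ , bs≡a = inj₂ (f s , f-mem s∈ , trans (sym (f-hom _ s)) (cong f bs≡a))

  GD-map : ∀ {a b} → G₁.GD a b → G₂.GD (f a) (f b)
  GD-map (c , c∈ , aLc , cRb) = f c , f-mem c∈ , GL-map aLc , GR-map cRb

  GJ-map : ∀ {a b} → G₁.GJ a b → G₂.GJ (f a) (f b)
  GJ-map (a≤b , b≤a) = ≤J-map a≤b , ≤J-map b≤a
    where
    ≤J-map : ∀ {a b} → G₁.≤J a b → G₂.≤J (f a) (f b)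
    ≤J-map {a} {b} a≤b with G₁.≤J⇒≤𝒥 a≤b
    ... | s , t , s∈ , t∈ , sbt≡a = G₂.≤𝒥⇒≤J (f s , f t , f-mem s∈ , f-mem t∈ ,
      trans (sym (trans (f-hom s _) (cong (f s ·₂_) (f-hom b t)))) (cong f sbt≡a))

module Retract {C₁ C₂ : Set} {_·₁_ : C₁ → C₁ → C₁} {_·₂_ : C₂ → C₂ → C₂}
               {Mem₁ : C₁ → Set} {Mem₂ : C₂ → Set} (S₂ : DJSubmonoid _·₂_ Mem₂)
               (φ : C₁ → C₂) (ψ : C₂ → C₁) (ψ∘φ : ∀ a → ψ (φ a) ≡ a)
               (φ-hom : ∀ a b → φ (a ·₁ b) ≡ φ a ·₂ φ b) (ψ-hom : ∀ a b → ψ (a ·₂ b) ≡ ψ a ·₁ ψ b)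
               (φ-mem : ∀ {a} → Mem₁ a → Mem₂ (φ a)) (ψ-mem : ∀ {a} → Mem₂ a → Mem₁ (ψ a)) where
  open DJSubmonoid S₂ renaming (submonoid to M₂)
  open Submonoid M₂ renaming (ε to ε₂)
  open ≡-Reasoning

  submonoid : Submonoid _·₁_ Mem₁
  submonoid = record
    { ε = ψ ε₂
    ; assoc = λ a b c → begin
        (a ·₁ b) ·₁ c                  ≡⟨ cong₂ _·₁_ (cong₂ _·₁_ (sym (ψ∘φ a)) (sym (ψ∘φ b))) (sym (ψ∘φ c)) ⟩
        (ψ (φ a) ·₁ ψ (φ b)) ·₁ ψ (φ c) ≡⟨ trans (cong (_·₁ ψ (φ c)) (sym (ψ-hom _ _))) (sym (ψ-hom _ _)) ⟩
        ψ ((φ a ·₂ φ b) ·₂ φ c)         ≡⟨ cong ψ (assoc (φ a) (φ b) (φ c)) ⟩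
        ψ (φ a ·₂ (φ b ·₂ φ c))         ≡⟨ trans (ψ-hom _ _) (cong (ψ (φ a) ·₁_) (ψ-hom _ _)) ⟩
        ψ (φ a) ·₁ (ψ (φ b) ·₁ ψ (φ c)) ≡⟨ cong₂ _·₁_ (ψ∘φ a) (cong₂ _·₁_ (ψ∘φ b) (ψ∘φ c)) ⟩
        a ·₁ (b ·₁ c)                  ∎
    ; identityˡ = λ a → begin
        ψ ε₂ ·₁ a       ≡⟨ cong (ψ ε₂ ·₁_) (sym (ψ∘φ a)) ⟩
        ψ ε₂ ·₁ ψ (φ a) ≡⟨ sym (ψ-hom ε₂ (φ a)) ⟩
        ψ (ε₂ ·₂ φ a)   ≡⟨ cong ψ (identityˡ (φ a)) ⟩
        ψ (φ a)         ≡⟨ ψ∘φ a ⟩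
        a               ∎
    ; identityʳ = λ a → begin
        a ·₁ ψ ε₂       ≡⟨ cong (_·₁ ψ ε₂) (sym (ψ∘φ a)) ⟩
        ψ (φ a) ·₁ ψ ε₂ ≡⟨ sym (ψ-hom (φ a) ε₂) ⟩
        ψ (φ a ·₂ ε₂)   ≡⟨ cong ψ (identityʳ (φ a)) ⟩
        ψ (φ a)         ≡⟨ ψ∘φ a ⟩
        a               ∎
    ; ε∈ = ψ-mem ε∈
    ; ·-closed = λ {a} {b} a∈ b∈ →
        subst Mem₁ (trans (ψ-hom _ _) (cong₂ _·₁_ (ψ∘φ a) (ψ∘φ b)))
              (ψ-mem (·-closed (φ-mem a∈) (φ-mem b∈)))
    }

  module Φ = GreenHomomorphism submonoid M₂ φ φ-hom φ-mem
  module Ψ = GreenHomomorphism M₂ submonoid ψ ψ-hom ψ-mem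

  djSubmonoid : DJSubmonoid _·₁_ Mem₁
  djSubmonoid = record
    { submonoid = submonoid
    ; GJ⇒GD = λ {a} {b} a∈ b∈ aJb →
        subst₂ (Green.GD _ Mem₁ _·₁_) (ψ∘φ a) (ψ∘φ b)
               (Ψ.GD-map (GJ⇒GD (φ-mem a∈) (φ-mem b∈) (Φ.GJ-map aJb)))
    }

≀-djSubmonoid : ∀ d {C : Set} {_·_ : C → C → C} {Mem : C → Set} (S : DJSubmonoid _·_ Mem) →
                DJSubmonoid (Wreath._⊙_ d (DJSubmonoid.submonoid S)) (Wreath.WMem d (DJSubmonoid.submonoid S))
≀-djSubmonoid d S = record
  { submonoid = Wreath.≀-submonoid d submonoid
  ; GJ⇒GD     = Wreath.GJ⇒GD d submonoid GJ⇒GD }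
  where open DJSubmonoid S

trivial-djSubmonoid : DJSubmonoid {⊤} (λ _ _ → tt) (λ _ → ⊤)
trivial-djSubmonoid = record
  { submonoid = record
    { ε = tt ; assoc = λ _ _ _ → refl ; identityˡ = λ _ → refl ; identityʳ = λ _ → refl
    ; ε∈ = tt ; ·-closed = λ _ _ → tt }
  ; GJ⇒GD = λ _ _ _ → tt , tt , (inj₁ refl , inj₁ refl) , (inj₁ refl , inj₁ refl) }

-- IS_d is isomorphic to the wreath product of the trivial monoid by IS_d
module SymmetricInverseMonoid (d : ℕ) where
  open Wreath d (DJSubmonoid.submonoid trivial-djSubmonoid)

  φ : Wr d 1 → W
  φ a = tabulate λ x → Maybe.map (_, tt) (lookup a x)

  ψ : W → Wr d 1
  ψ u = tabulate λ x → Maybe.map proj₁ (lookup u x)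

  ψ∘φ : ∀ a → ψ (φ a) ≡ a
  ψ∘φ a = lookup-ext λ x → begin
    lookup (ψ (φ a)) x                                     ≡⟨ lookup∘tabulate _ x ⟩
    Maybe.map proj₁ (lookup (φ a) x)                       ≡⟨ cong (Maybe.map proj₁) (lookup∘tabulate _ x) ⟩
    Maybe.map proj₁ (Maybe.map (_, tt) (lookup a x))       ≡⟨ map-∘ (lookup a x) ⟨
    Maybe.map (λ y → y) (lookup a x)                       ≡⟨ map-id (lookup a x) ⟩
    lookup a x                                             ∎
    where open ≡-Reasoning

  φ-hom : ∀ a b → φ (mul d 1 a b) ≡ φ a ⊙ φ b
  φ-hom a b = lookup-ext λ x → begin
    lookup (φ (mul d 1 a b)) x                              ≡⟨ lookup∘tabulate _ x ⟩
    Maybe.map (_, tt) (lookup (mul d 1 a b) x)              ≡⟨ cong (Maybe.map (_, tt)) (lookup∘tabulate _ x) ⟩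
    Maybe.map (_, tt) (isstep b (lookup a x))               ≡⟨ step (lookup a x) ⟩
    wstep _ (φ b) (Maybe.map (_, tt) (lookup a x))          ≡⟨ cong (wstep _ (φ b)) (lookup∘tabulate _ x) ⟨
    wstep _ (φ b) (lookup (φ a) x)                          ≡⟨ lookup-⊙ (φ a) (φ b) x ⟨
    lookup (φ a ⊙ φ b) x                                    ∎
    where
    open ≡-Reasoning
    step : ∀ m → Maybe.map (_, tt) (isstep b m) ≡ wstep _ (φ b) (Maybe.map (_, tt) m)
    step nothing  = refl
    step (just y) = sym (trans (wstep-just (φ b) y tt)
      (trans (cong (Maybe.map _) (lookup∘tabulate _ y)) (sym (map-∘ (lookup b y)))))

  ψ-hom : ∀ u v → ψ (u ⊙ v) ≡ mul d 1 (ψ u) (ψ v)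
  ψ-hom u v = lookup-ext λ x → begin
    lookup (ψ (u ⊙ v)) x                                    ≡⟨ lookup∘tabulate _ x ⟩
    Maybe.map proj₁ (lookup (u ⊙ v) x)                      ≡⟨ cong (Maybe.map proj₁) (lookup-⊙ u v x) ⟩
    Maybe.map proj₁ (wstep _ v (lookup u x))                ≡⟨ step (lookup u x) ⟩
    isstep (ψ v) (Maybe.map proj₁ (lookup u x))             ≡⟨ cong (isstep (ψ v)) (lookup∘tabulate _ x) ⟨
    isstep (ψ v) (lookup (ψ u) x)                           ≡⟨ lookup∘tabulate _ x ⟨
    lookup (mul d 1 (ψ u) (ψ v)) x                          ∎
    where
    open ≡-Reasoning
    step : ∀ m → Maybe.map proj₁ (wstep _ v m) ≡ isstep (ψ v) (Maybe.map proj₁ m)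
    step nothing        = refl
    step (just (y , _)) = trans (cong (Maybe.map proj₁) (wstep-just v y tt))
      (trans (sym (map-∘ (lookup v y))) (sym (lookup∘tabulate _ y)))

  φ-mem : ∀ {a} → Mem d 1 a → WMem (φ a)
  φ-mem {a} a-inj = (λ x y z _ _ φax φay → a-inj x y z (lookup-a φax) (lookup-a φay)) , λ _ _ _ _ → tt
    where
    lookup-a : ∀ {x z} {s : ⊤} → lookup (φ a) x ≡ just (z , s) → lookup a x ≡ just z
    lookup-a {x} φax = map-injective ,-injectiveˡ (trans (sym (lookup∘tabulate _ x)) φax)

  ψ-mem : ∀ {u} → WMem u → Mem d 1 (ψ u)
  ψ-mem {u} (u-inj , _) x y z ψux ψuy = u-inj x y z tt tt (lookup-u ψux) (lookup-u ψuy)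
    where
    lookup-u : ∀ {x z} → lookup (ψ u) x ≡ just z → lookup u x ≡ just (z , tt)
    lookup-u {x} ψux = map-injective (cong (_, tt)) (trans (sym (lookup∘tabulate _ x)) ψux)

  djSubmonoid : DJSubmonoid (mul d 1) (Mem d 1)
  djSubmonoid = Retract.djSubmonoid (≀-djSubmonoid d trivial-djSubmonoid) φ ψ ψ∘φ φ-hom ψ-hom
    (λ {a} → φ-mem {a}) (λ {u} → ψ-mem {u})

iterated-djSubmonoid : (d n : ℕ) → DJSubmonoid (mul d (suc n)) (Mem d (suc n))
iterated-djSubmonoid d zero    = SymmetricInverseMonoid.djSubmonoid d
iterated-djSubmonoid d (suc n) = ≀-djSubmonoid d (iterated-djSubmonoid d n)

mainTheorem5 : (d : ℕ) → 1 ≤ d → (n : ℕ) →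
  (u v : Wr d (suc (suc n))) → Mem d (suc (suc n)) u → Mem d (suc (suc n)) v →
  -- (1) L
  (𝓛 d (suc (suc n)) u v ⇔
    ((∀ z → InRan d n u z ⇔ InRan d n v z) ×
     (∀ (z x y : Fin d) (s t : Wr d (suc n)) →
        lookup u x ≡ just (z , s) → lookup v y ≡ just (z , t) → 𝓛 d (suc n) t s)))
  ×
  -- (2) R
  (𝓡 d (suc (suc n)) u v ⇔
    ((∀ x → InDom d n u x ⇔ InDom d n v x) ×
     (∀ (x y₁ y₂ : Fin d) (s t : Wr d (suc n)) →
        lookup u x ≡ just (y₁ , s) → lookup v x ≡ just (y₂ , t) → 𝓡 d (suc n) s t)))
  ×
  -- (3) H
  (𝓗 d (suc (suc n)) u v ⇔
    ((∀ z → InRan d n u z ⇔ InRan d n v z) ×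
     (∀ x → InDom d n u x ⇔ InDom d n v x) ×
     (∀ (z x y : Fin d) (s t : Wr d (suc n)) →
        lookup u x ≡ just (z , s) → lookup v y ≡ just (z , t) → 𝓛 d (suc n) t s) ×
     (∀ (x y₁ y₂ : Fin d) (s t : Wr d (suc n)) →
        lookup u x ≡ just (y₁ , s) → lookup v x ≡ just (y₂ , t) → 𝓡 d (suc n) s t)))
  ×
  -- (4) D : a bijection χ : dom(b) → dom(a) with f(zχ) D g(z)
  (𝓓 d (suc (suc n)) u v ⇔
    (Σ[ χ ∈ (Fin d → Fin d) ]
      ((∀ (z : Fin d) → InDom d n v z → InDom d n u (χ z)) ×
       (∀ z z′ → InDom d n v z → InDom d n v z′ → χ z ≡ χ z′ → z ≡ z′) ×
       (∀ y → InDom d n u y → ∃[ z ] (InDom d n v z × χ z ≡ y)) ×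
       (∀ (z p q : Fin d) (s t : Wr d (suc n)) →
          lookup v z ≡ just (q , t) → lookup u (χ z) ≡ just (p , s) → 𝓓 d (suc n) s t))))
  ×
  -- (5) D = J
  (𝓓 d (suc (suc n)) u v ⇔ 𝓙 d (suc (suc n)) u v)
mainTheorem5 d _ n u v u∈ v∈ =
  GL⇔ {u} {v} u∈ v∈ , GR⇔ {u} {v} u∈ v∈ , GH⇔ {u} {v} u∈ v∈ , GD⇔ {u} {v} u∈ v∈ ,
  mk⇔ ≀.GD⇒GJ (GJ⇒GD coefficient-GJ⇒GD {u} {v} u∈ v∈)
  where
  open DJSubmonoid (iterated-djSubmonoid d n) renaming (GJ⇒GD to coefficient-GJ⇒GD)
  open Wreath d submonoid
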